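{- For all integers $k\ge 2$, $c_{k,k}=1$ and $c_{k,2}=\binom{k}{2}$.
   Context: Let $H_{n,k}=\{0,1,\dots,n-1\}^k$. For $2\le\ell\le k$, an $\ell$-rook is a point $P\in H_{n,k}$ together with a set $D$ of $\ell$ of the $k$ coordinate indices; it covers $P$ itself and every point of $H_{n,k}$ which differs from $P$ in exactly one coordinate, that coordinate belonging to $D$. Distinct rooks must occupy distinct points. $c_{n,k,\ell}$ is the maximum number of $\ell$-rooks that can be placed in $H_{n,k}$ so that no point is covered by two different rooks, and $c_{k,\ell}=\lim_{n\to\infty} c_{n,k,\ell}/n^{k-2}$ (this limit exists). -}

module Defs where

open import Data.Nat using (ℕ; _≤_; _∸_; _^_)
open import Data.Integer using (+_)
open import Data.Fin using (Fin)
open import Data.Fin.Subset using (Subset; _∈_; ∣_∣)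
open import Data.Vec using (Vec; lookup)
open import Data.List using (List; length) renaming (lookup to lookupL)
open import Data.Product using (Σ; ∃; _×_; proj₁)
open import Data.Sum using (_⊎_)
open import Relation.Nullary using (¬_)
open import Relation.Binary.PropositionalEquality using (_≡_; _≢_)
open import Data.Rational using (ℚ; _/_; _*_; _-_; _<_; 0ℚ) renaming (∣_∣ to absℚ)

Point : ℕ → ℕ → Set
Point n k = Vec (Fin n) k

record Rook (n k ℓ : ℕ) : Set where
  constructor rook
  field
    pos  : Point n k
    dirs : Subset k
    size : ∣ dirs ∣ ≡ ℓ
open Rook public

Covers : ∀ {n k ℓ} → Rook n k ℓ → Point n k → Set
Covers r Q =
  Q ≡ pos r ⊎
  Σ (Fin _) λ i → i ∈ dirs r × lookup Q i ≢ lookup (pos r) i ×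
    (∀ j → j ≢ i → lookup Q j ≡ lookup (pos r) j)

Valid : ∀ {n k ℓ} → List (Rook n k ℓ) → Set
Valid {n} {k} rs = ∀ (a b : Fin (length rs)) → a ≢ b →
  (pos (lookupL rs a) ≢ pos (lookupL rs b)) ×
  (∀ (Q : Point n k) → ¬ (Covers (lookupL rs a) Q × Covers (lookupL rs b) Q))

IsMax : ℕ → ℕ → ℕ → ℕ → Set
IsMax n k ℓ m =
  (Σ (List (Rook n k ℓ)) λ rs → Valid rs × length rs ≡ m) ×
  (∀ (rs : List (Rook n k ℓ)) → Valid rs → length rs ≤ m)

ℕ→ℚ : ℕ → ℚ
ℕ→ℚ m = + m / 1

-- x = c_{n,k,ℓ} / n^{k-2}  (stated multiplicatively; determines x whenever n ≥ 1)
NormCount : ℕ → ℕ → ℕ → ℚ → Set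
NormCount k ℓ n x = ∃ λ m → IsMax n k ℓ m × x * ℕ→ℚ (n ^ (k ∸ 2)) ≡ ℕ→ℚ m

-- c_{k,ℓ} = L, i.e. lim_{n→∞} c_{n,k,ℓ}/n^{k-2} = L
CLimit : ℕ → ℕ → ℚ → Set
CLimit k ℓ L = ∀ (ε : ℚ) → 0ℚ < ε → ∃ λ N → ∀ n → N ≤ n → ∀ x →
  NormCount k ℓ n x → absℚ (x - L) < ε

module Submission where

open import Defs
open import Data.Nat using (ℕ; _≤_)
open import Data.Nat.Combinatorics using (_C_)
open import Data.Product using (_×_)
open import Data.Rational using (1ℚ)

open import Data.Nat as ℕ using (zero; suc; _+_; _*_; _∸_; _^_; _<_; z≤n; s≤s; NonZero; >-nonZero; _!)
open import Data.Nat.Properties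
open import Data.Nat.Combinatorics using (nC1≡n; nCk+nC[k+1]≡[n+1]C[k+1])
open import Data.Nat.Coprimality using (1-coprimeTo) renaming (sym to coprime-sym)
open import Data.Nat.DivMod using (_%_; _/_; m<n⇒m%n≡m; m%n<n; m≡m%n+[m/n]*n)
import Data.Nat.Divisibility as ℕ∣
import Data.Nat.Solver
open import Data.Integer as ℤ using (ℤ; +_; -[1+_]; _%ℕ_; _/ℕ_)
import Data.Integer.Properties as ℤP
open import Data.Integer.DivMod using (n%ℕd<d; a≡a%ℕn+[a/ℕn]*n)
open import Data.Integer.Divisibility.Signed using (_∣_; divides; ∣-refl; ∣⇒∣ᵤ; ∣m∣n⇒∣m-n; ∣n⇒∣m*n)
import Data.Integer.Solver
open import Data.Rational as ℚ using (ℚ; mkℚ; 0ℚ)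
import Data.Rational.Properties as ℚP
import Data.Rational.Unnormalised as ℚᵘ
import Data.Rational.Unnormalised.Properties as ℚᵘP
import Data.Rational.Solver
open import Data.Fin as F using (Fin; zero; suc; toℕ)
import Data.Fin.Properties as FP
open import Data.Fin.Subset using (Subset; _∈_; ∣_∣; ⊤; ⁅_⁆; inside; outside) renaming (⊥ to ∅)
import Data.Fin.Subset.Properties as SP
open import Data.Vec as V using (Vec; []; _∷_; lookup; tabulate; here; there)
import Data.Vec.Properties as VP
open import Data.List as L using (length)
import Data.List.Properties as LP
open import Data.Product using (∃; ∃₂; _,_; proj₁; proj₂)
open import Data.Sum using (_⊎_; inj₁; inj₂)
open import Data.Empty using (⊥-elim)
open import Function using (_∘_)
open import Relation.Nullary using (¬_; yes; no)
open import Relation.Binary.Definitions using (tri<; tri≈; tri>)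
open import Relation.Binary.PropositionalEquality

-- Two rooks conflict exactly when their positions agree outside one direction of each. So a k-rook
-- is determined up to conflict by its last k − 2 coordinates, and a 2-rook by its pair of
-- directions together with its other k − 2 coordinates: c_{n,k,k} ≤ n^{k−2} and
-- c_{n,k,2} ≤ C(k,2)·n^{k−2}. Conversely, for q = 1 + t·(k−2)! ≤ n the words (Σ xᵢ, Σ (i+1)·xᵢ, x)
-- mod q, x ∈ [q]^{k−2}, pairwise differ in at least three coordinates, because every weight
-- difference is invertible mod q; this places (n − (k−2)!)^{k−2} k-rooks. For ℓ = 2, reserve k of
-- the n values as labels and, for each pair {i, j} of directions, write label j at coordinate i and
-- label i at coordinate j; this places C(k,2)·(n − k)^{k−2} 2-rooks. Both bounds have the form
-- c·n^{k−2}(1 − O(1/n)), which gives the limits.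

-- The limit from two-sided bounds on the maximum

ℕ→ℚ-normal : ∀ m → ℕ→ℚ m ≡ mkℚ (+ m) 0 (coprime-sym (1-coprimeTo m))
ℕ→ℚ-normal m = ℚP.normalize-coprime (coprime-sym (1-coprimeTo m))

ℕ→ℚ-+ : ∀ a b → ℕ→ℚ (a + b) ≡ ℕ→ℚ a ℚ.+ ℕ→ℚ b
ℕ→ℚ-+ a b rewrite ℕ→ℚ-normal a | ℕ→ℚ-normal b
                | ℤP.*-identityʳ (+ a) | ℤP.*-identityʳ (+ b) | sym (ℤP.pos-+ a b) = refl

ℕ→ℚ-* : ∀ a b → ℕ→ℚ (a * b) ≡ ℕ→ℚ a ℚ.* ℕ→ℚ b
ℕ→ℚ-* a b rewrite ℕ→ℚ-normal a | ℕ→ℚ-normal b | sym (ℤP.pos-* a b) = refl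

ℕ→ℚ-mono-< : ∀ {a b} → a < b → ℕ→ℚ a ℚ.< ℕ→ℚ b
ℕ→ℚ-mono-< {a} {b} a<b rewrite ℕ→ℚ-normal a | ℕ→ℚ-normal b =
  ℚ.*<* (subst₂ ℤ._<_ (sym (ℤP.*-identityʳ (+ a))) (sym (ℤP.*-identityʳ (+ b))) (ℤ.+<+ a<b))

ℕ→ℚ-nonNegative : ∀ m → ℚ.NonNegative (ℕ→ℚ m)
ℕ→ℚ-nonNegative m = subst ℚ.NonNegative (sym (ℕ→ℚ-normal m)) _

ℕ→ℚ-positive : ∀ m → ℚ.Positive (ℕ→ℚ (suc m))
ℕ→ℚ-positive m = subst ℚ.Positive (sym (ℕ→ℚ-normal (suc m))) _

positive⇒fraction : ∀ {ε} → 0ℚ ℚ.< ε → ∃₂ λ p s → ε ℚ.* ℕ→ℚ (suc s) ≡ ℕ→ℚ (suc p)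
positive⇒fraction {mkℚ (+ zero) s _} (ℚ.*<* (ℤ.+<+ ()))
positive⇒fraction {mkℚ -[1+ _ ] s _} (ℚ.*<* ())
positive⇒fraction {ε@(mkℚ (+ suc p) s _)} _ = p , s , ℚP.toℚᵘ-injective
  (ℚᵘP.≃-trans (ℚP.toℚᵘ-homo-* ε (ℕ→ℚ (suc s))) cross-multiplied)
  where
  cross-multiplied : ℚ.toℚᵘ ε ℚᵘ.* ℚ.toℚᵘ (ℕ→ℚ (suc s)) ℚᵘ.≃ ℚ.toℚᵘ (ℕ→ℚ (suc p))
  cross-multiplied rewrite ℕ→ℚ-normal (suc s) | ℕ→ℚ-normal (suc p) =
    ℚᵘ.*≡* (cong (λ z → + suc z) (solve 2 (λ p s → (s :+ p :* (con 1 :+ s)) :* con 1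
                                              := s :* con 1 :+ p :* (con 1 :+ s :* con 1)) refl p s))
    where open Data.Nat.Solver.+-*-Solver

0≤q-p⇒∣p-q∣≡q-p : ∀ {p q : ℚ} → 0ℚ ℚ.≤ q ℚ.- p → ℚ.∣ p ℚ.- q ∣ ≡ q ℚ.- p
0≤q-p⇒∣p-q∣≡q-p {p} {q} 0≤q-p = begin
  ℚ.∣ p ℚ.- q ∣          ≡⟨ cong ℚ.∣_∣ (solve 2 (λ p q → p :- q := :- (q :- p)) refl p q) ⟩
  ℚ.∣ ℚ.- (q ℚ.- p) ∣    ≡⟨ ℚP.∣-p∣≡∣p∣ (q ℚ.- p) ⟩
  ℚ.∣ q ℚ.- p ∣          ≡⟨ ℚP.0≤p⇒∣p∣≡p 0≤q-p ⟩
  q ℚ.- p                ∎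
  where
  open ≡-Reasoning
  open Data.Rational.Solver.+-*-Solver

[c-x]*D≡c*D∸m : ∀ {x : ℚ} {D m c : ℕ} → x ℚ.* ℕ→ℚ D ≡ ℕ→ℚ m → m ≤ c * D →
  (ℕ→ℚ c ℚ.- x) ℚ.* ℕ→ℚ D ≡ ℕ→ℚ (c * D ∸ m)
[c-x]*D≡c*D∸m {x} {D} {m} {c} xD≡m m≤cD = begin
  (cℚ ℚ.- x) ℚ.* Dℚ           ≡⟨ solve 3 (λ c x d → (c :- x) :* d := c :* d :- x :* d) refl cℚ x Dℚ ⟩
  cℚ ℚ.* Dℚ ℚ.- x ℚ.* Dℚ      ≡⟨ cong₂ ℚ._-_ (sym (ℕ→ℚ-* c D)) xD≡m ⟩
  ℕ→ℚ (c * D) ℚ.- ℕ→ℚ m       ≡⟨ cong (λ z → ℕ→ℚ z ℚ.- ℕ→ℚ m) (sym (m∸n+n≡m m≤cD)) ⟩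
  ℕ→ℚ (E + m) ℚ.- ℕ→ℚ m       ≡⟨ cong (ℚ._- ℕ→ℚ m) (ℕ→ℚ-+ E m) ⟩
  ℕ→ℚ E ℚ.+ ℕ→ℚ m ℚ.- ℕ→ℚ m   ≡⟨ solve 2 (λ e m → e :+ m :- m := e) refl (ℕ→ℚ E) (ℕ→ℚ m) ⟩
  ℕ→ℚ E                       ∎
  where
  open ≡-Reasoning
  open Data.Rational.Solver.+-*-Solver
  Dℚ = ℕ→ℚ D
  cℚ = ℕ→ℚ c
  E = c * D ∸ m

deficit⇒∣x-c∣<ε : ∀ {x ε : ℚ} {D m c p s : ℕ} → 0 < D →
  x ℚ.* ℕ→ℚ D ≡ ℕ→ℚ m → m ≤ c * D → ε ℚ.* ℕ→ℚ (suc s) ≡ ℕ→ℚ (suc p) →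
  (c * D ∸ m) * suc s < suc p * D → ℚ.∣ x ℚ.- ℕ→ℚ c ∣ ℚ.< ε
deficit⇒∣x-c∣<ε {x} {ε} {suc D} {m} {c} {p} {s} _ xD≡m m≤cD εS≡P E*S<P*D =
  subst (ℚ._< ε) (sym (0≤q-p⇒∣p-q∣≡q-p {x} {ℕ→ℚ c} 0≤c-x)) c-x<ε
  where
  open Data.Rational.Solver.+-*-Solver
  Dℚ = ℕ→ℚ (suc D)
  Sℚ = ℕ→ℚ (suc s)
  E = c * suc D ∸ m
  instance
    _ = ℕ→ℚ-positive D
    _ = ℕ→ℚ-nonNegative (suc D)
    _ = ℕ→ℚ-nonNegative (suc s)
    _ = ℕ→ℚ-nonNegative E
  [c-x]*D≡E : (ℕ→ℚ c ℚ.- x) ℚ.* Dℚ ≡ ℕ→ℚ E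
  [c-x]*D≡E = [c-x]*D≡c*D∸m {x} {suc D} {m} {c} xD≡m m≤cD

  0≤c-x : 0ℚ ℚ.≤ ℕ→ℚ c ℚ.- x
  0≤c-x = ℚP.*-cancelʳ-≤-pos Dℚ
    (subst₂ ℚ._≤_ (sym (ℚP.*-zeroˡ Dℚ)) (sym [c-x]*D≡E) (ℚP.nonNegative⁻¹ (ℕ→ℚ E)))

  P*D≡εD*S : ℕ→ℚ (suc p * suc D) ≡ (ε ℚ.* Dℚ) ℚ.* Sℚ
  P*D≡εD*S = begin
    ℕ→ℚ (suc p * suc D)        ≡⟨ ℕ→ℚ-* (suc p) (suc D) ⟩
    ℕ→ℚ (suc p) ℚ.* Dℚ         ≡⟨ cong (ℚ._* Dℚ) (sym εS≡P) ⟩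
    (ε ℚ.* Sℚ) ℚ.* Dℚ          ≡⟨ solve 3 (λ e s d → (e :* s) :* d := (e :* d) :* s) refl ε Sℚ Dℚ ⟩
    (ε ℚ.* Dℚ) ℚ.* Sℚ          ∎
    where open ≡-Reasoning

  c-x<ε : ℕ→ℚ c ℚ.- x ℚ.< ε
  c-x<ε = ℚP.*-cancelʳ-<-nonNeg Dℚ (subst (ℚ._< ε ℚ.* Dℚ) (sym [c-x]*D≡E)
    (ℚP.*-cancelʳ-<-nonNeg Sℚ (subst₂ ℚ._<_ (ℕ→ℚ-* E (suc s)) P*D≡εD*S (ℕ→ℚ-mono-< E*S<P*D))))

^-∸-deficit : ∀ n K d → n ^ suc d ≤ (n ∸ K) ^ suc d + suc d * K * n ^ d
^-∸-deficit n K zero = subst₂ _≤_ (sym (*-identityʳ n))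
  (cong₂ _+_ (sym (*-identityʳ (n ∸ K))) (sym (trans (*-identityʳ _) (+-identityʳ K))))
  (subst (n ≤_) (+-comm K (n ∸ K)) (m≤n+m∸n n K))
^-∸-deficit n K (suc d) = begin
  n * n ^ suc d
    ≤⟨ *-monoʳ-≤ n (^-∸-deficit n K d) ⟩
  n * (a ^ suc d + suc d * K * n ^ d)
    ≡⟨ *-distribˡ-+ n (a ^ suc d) _ ⟩
  n * a ^ suc d + n * (suc d * K * n ^ d)
    ≤⟨ +-monoˡ-≤ _ (*-monoˡ-≤ (a ^ suc d) (m≤n+m∸n n K)) ⟩
  (K + a) * a ^ suc d + n * (suc d * K * n ^ d)
    ≡⟨ cong (_+ n * (suc d * K * n ^ d)) (*-distribʳ-+ (a ^ suc d) K a) ⟩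
  K * a ^ suc d + a ^ suc (suc d) + n * (suc d * K * n ^ d)
    ≤⟨ +-monoˡ-≤ _ (+-monoˡ-≤ _ (*-monoʳ-≤ K (^-monoˡ-≤ (suc d) (m∸n≤m n K)))) ⟩
  K * n ^ suc d + a ^ suc (suc d) + n * (suc d * K * n ^ d)
    ≡⟨ solve 5 (λ K n nᵈ a² d → K :* (n :* nᵈ) :+ a² :+ n :* ((con 1 :+ d) :* K :* nᵈ)
                              := a² :+ (con 2 :+ d) :* K :* (n :* nᵈ))
               refl K n (n ^ d) (a ^ suc (suc d)) d ⟩
  a ^ suc (suc d) + suc (suc d) * K * n ^ suc d
    ∎
  where
  open ≤-Reasoning
  open Data.Nat.Solver.+-*-Solver
  a = n ∸ K

∸-deficit<fraction : ∀ {n K d c m p s} → c * (n ∸ K) ^ d ≤ m → c * d * K * suc s < n →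
  (c * n ^ d ∸ m) * suc s < suc p * n ^ d
∸-deficit<fraction {d = zero} {m = m} lower _ rewrite m≤n⇒m∸n≡0 lower = s≤s z≤n
∸-deficit<fraction {n} {K} {suc e} {c} {m} {p} {s} lower cdKS<n = begin-strict
  (c * n ^ suc e ∸ m) * suc s
    ≤⟨ *-monoˡ-≤ (suc s) deficit≤ ⟩
  c * (suc e * K * n ^ e) * suc s
    ≡⟨ solve 5 (λ c e K nᵉ s → c :* ((con 1 :+ e) :* K :* nᵉ) :* (con 1 :+ s)
                              := c :* (con 1 :+ e) :* K :* (con 1 :+ s) :* nᵉ)
               refl c e K (n ^ e) s ⟩
  c * suc e * K * suc s * n ^ e
    <⟨ *-monoˡ-< (n ^ e) {{>-nonZero (m^n>0 n {{>-nonZero 0<n}} e)}} cdKS<n ⟩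
  n * n ^ e
    ≤⟨ m≤m+n (n * n ^ e) (p * (n * n ^ e)) ⟩
  suc p * n ^ suc e
    ∎
  where
  open ≤-Reasoning
  open Data.Nat.Solver.+-*-Solver
  0<n : 0 < n
  0<n = ≤-trans (s≤s z≤n) cdKS<n
  deficit≤ : c * n ^ suc e ∸ m ≤ c * (suc e * K * n ^ e)
  deficit≤ = m≤n+o⇒m∸n≤o _ m (begin
    c * n ^ suc e                                 ≤⟨ *-monoʳ-≤ c (^-∸-deficit n K e) ⟩
    c * ((n ∸ K) ^ suc e + suc e * K * n ^ e)     ≡⟨ *-distribˡ-+ c _ _ ⟩
    c * (n ∸ K) ^ suc e + c * (suc e * K * n ^ e) ≤⟨ +-monoˡ-≤ _ lower ⟩
    m + c * (suc e * K * n ^ e)                   ∎)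

sandwich⇒CLimit : ∀ {k ℓ} c K n₀ →
  (∀ n → n₀ ≤ n → ∀ m → IsMax n k ℓ m → c * (n ∸ K) ^ (k ∸ 2) ≤ m × m ≤ c * n ^ (k ∸ 2)) →
  CLimit k ℓ (ℕ→ℚ c)
sandwich⇒CLimit {k} {ℓ} c K n₀ sandwich ε 0<ε with positive⇒fraction 0<ε
... | p , s , εS≡P = n₀ + suc W , λ { n N≤n x (m , max , xD≡m) → close n N≤n x m max xD≡m }
  where
  d = k ∸ 2
  W = c * d * K * suc s
  close : ∀ n → n₀ + suc W ≤ n → ∀ x m → IsMax n k ℓ m → x ℚ.* ℕ→ℚ (n ^ d) ≡ ℕ→ℚ m →
          ℚ.∣ x ℚ.- ℕ→ℚ c ∣ ℚ.< ε
  close n N≤n x m max xD≡m = deficit⇒∣x-c∣<ε {x} {c = c} {p = p} (m^n>0 n {{>-nonZero 0<n}} d)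
    xD≡m (proj₂ bounds) εS≡P (∸-deficit<fraction {K = K} {d = d} {c = c} {p = p} (proj₁ bounds) W<n)
    where
    W<n : W < n
    W<n = ≤-trans (m≤n+m (suc W) n₀) N≤n
    0<n : 0 < n
    0<n = ≤-trans (s≤s z≤n) W<n
    bounds = sandwich n (≤-trans (m≤m+n n₀ (suc W)) N≤n) m max

-- Conflicting rooks

lookup-ext : ∀ {A : Set} {k} {u v : Vec A k} → (∀ i → lookup u i ≡ lookup v i) → u ≡ v
lookup-ext {u = u} {v} u≗v =
  trans (sym (VP.tabulate∘lookup u)) (trans (VP.tabulate-cong u≗v) (VP.tabulate∘lookup v))

AgreeOutside : ∀ {A : Set} {k} → Vec A k → Vec A k → Fin k → Fin k → Set
AgreeOutside u v i j = ∀ c → c ≢ i → c ≢ j → lookup u c ≡ lookup v c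

swap-agreeOutside : ∀ {A : Set} {k} {u v : Vec A k} {i j} →
  AgreeOutside u v i j → AgreeOutside u v j i
swap-agreeOutside agree c c≢j c≢i = agree c c≢i c≢j

agreeOutside-map⁻¹ : ∀ {A B : Set} {k} {f : A → B} {u v : Vec A k} {i j} →
  (∀ {a b} → f a ≡ f b → a ≡ b) → AgreeOutside (V.map f u) (V.map f v) i j → AgreeOutside u v i j
agreeOutside-map⁻¹ {f = f} {u} {v} f-injective agree c c≢i c≢j =
  f-injective (trans (sym (VP.lookup-map c f u)) (trans (agree c c≢i c≢j) (VP.lookup-map c f v)))

Conflict : ∀ {n k ℓ} → Rook n k ℓ → Rook n k ℓ → Set
Conflict r r' = pos r ≡ pos r' ⊎ ∃ λ Q → Covers r Q × Covers r' Q

agree-except⇒covers : ∀ {n k ℓ} (r : Rook n k ℓ) {Q i} → i ∈ dirs r →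
  (∀ c → c ≢ i → lookup Q c ≡ lookup (pos r) c) → Covers r Q
agree-except⇒covers r {Q} {i} i∈D agree with lookup Q i FP.≟ lookup (pos r) i
... | no  Qᵢ≢Pᵢ = inj₂ (i , i∈D , Qᵢ≢Pᵢ , agree)
... | yes Qᵢ≡Pᵢ = inj₁ (lookup-ext Q≗P)
  where
  Q≗P : ∀ c → lookup Q c ≡ lookup (pos r) c
  Q≗P c with c FP.≟ i
  ... | yes refl = Qᵢ≡Pᵢ
  ... | no  c≢i  = agree c c≢i

-- The common covered point takes the value of r' at i and of r elsewhere.
agreeOutside⇒conflict : ∀ {n k ℓ} (r r' : Rook n k ℓ) {i j} → i ∈ dirs r → j ∈ dirs r' →
  AgreeOutside (pos r) (pos r') i j → Conflict r r'
agreeOutside⇒conflict r r' {i} {j} i∈D j∈D' agree =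
  inj₂ (Q , agree-except⇒covers r i∈D Q≈r , agree-except⇒covers r' j∈D' Q≈r')
  where
  mixed : Fin _ → Fin _
  mixed c with c FP.≟ i
  ... | yes _ = lookup (pos r') c
  ... | no  _ = lookup (pos r) c
  Q = tabulate mixed
  Q≈r : ∀ c → c ≢ i → lookup Q c ≡ lookup (pos r) c
  Q≈r c c≢i rewrite VP.lookup∘tabulate mixed c with c FP.≟ i
  ... | yes c≡i = ⊥-elim (c≢i c≡i)
  ... | no  _   = refl
  Q≈r' : ∀ c → c ≢ j → lookup Q c ≡ lookup (pos r') c
  Q≈r' c c≢j rewrite VP.lookup∘tabulate mixed c with c FP.≟ i
  ... | yes _   = refl
  ... | no  c≢i = agree c c≢i c≢j

conflict⇒agreeOutside : ∀ {n k ℓ} (r r' : Rook n k ℓ) {i₀ j₀} → i₀ ∈ dirs r → j₀ ∈ dirs r' →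
  Conflict r r' → ∃₂ λ i j → i ∈ dirs r × j ∈ dirs r' × AgreeOutside (pos r) (pos r') i j
conflict⇒agreeOutside r r' {i₀} {j₀} i₀∈D j₀∈D' (inj₁ P≡P') =
  i₀ , j₀ , i₀∈D , j₀∈D' , λ c _ _ → cong (λ v → lookup v c) P≡P'
conflict⇒agreeOutside r r' {i₀} {j₀} i₀∈D j₀∈D' (inj₂ (Q , cover , cover')) with cover | cover'
... | inj₁ Q≡P | inj₁ Q≡P' =
  i₀ , j₀ , i₀∈D , j₀∈D' , λ c _ _ → cong (λ v → lookup v c) (trans (sym Q≡P) Q≡P')
... | inj₁ Q≡P | inj₂ (j , j∈D' , _ , Q≈P') =
  i₀ , j , i₀∈D , j∈D' , λ c _ c≢j → trans (sym (cong (λ v → lookup v c) Q≡P)) (Q≈P' c c≢j)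
... | inj₂ (i , i∈D , _ , Q≈P) | inj₁ Q≡P' =
  i , j₀ , i∈D , j₀∈D' , λ c c≢i _ → trans (sym (Q≈P c c≢i)) (cong (λ v → lookup v c) Q≡P')
... | inj₂ (i , i∈D , _ , Q≈P) | inj₂ (j , j∈D' , _ , Q≈P') =
  i , j , i∈D , j∈D' , λ c c≢i c≢j → trans (sym (Q≈P c c≢i)) (Q≈P' c c≢j)

max≤ : ∀ {n k ℓ m} B (label : Rook n k ℓ → Fin B) → (∀ r r' → label r ≡ label r' → Conflict r r') →
  IsMax n k ℓ m → m ≤ B
max≤ B label conflicting ((rs , valid , refl) , _) with length rs ≤? B
... | yes ≤B = ≤B
... | no  ≰B with FP.pigeonhole (≰⇒> ≰B) (λ a → label (L.lookup rs a))
... | a , b , a<b , same with conflicting _ _ same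
... | inj₁ P≡P'       = ⊥-elim (proj₁ (valid a b (FP.<⇒≢ a<b)) P≡P')
... | inj₂ (Q , both) = ⊥-elim (proj₂ (valid a b (FP.<⇒≢ a<b)) Q both)

≤max : ∀ {n k ℓ m} N (g : Fin N → Rook n k ℓ) → (∀ a b → a ≢ b → ¬ Conflict (g a) (g b)) →
  IsMax n k ℓ m → N ≤ m
≤max N g conflict-free (_ , maximal) =
  subst (_≤ _) (LP.length-tabulate g) (maximal (L.tabulate g) valid)
  where
  len = LP.length-tabulate g
  index : Fin (length (L.tabulate g)) → Fin N
  index = F.cast len
  lookup-tabulate : ∀ a → L.lookup (L.tabulate g) a ≡ g (index a)
  lookup-tabulate a = subst (λ a′ → L.lookup (L.tabulate g) a′ ≡ g (index a))
    (FP.cast-involutive (sym len) len a) (LP.lookup-tabulate g (index a))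
  valid : Valid (L.tabulate g)
  valid a b a≢b rewrite lookup-tabulate a | lookup-tabulate b =
    (λ P≡P' → conflict-free _ _ ia≢ib (inj₁ P≡P')) , λ Q both → conflict-free _ _ ia≢ib (inj₂ (Q , both))
    where
    ia≢ib : index a ≢ index b
    ia≢ib eq = a≢b (FP.toℕ-injective
      (trans (sym (FP.toℕ-cast len a)) (trans (cong toℕ eq) (FP.toℕ-cast len b))))

-- Rooks with all k directions

encode : ∀ {n d} → Vec (Fin n) d → Fin (n ^ d)
encode []       = zero
encode (x ∷ xs) = F.combine x (encode xs)

encode-injective : ∀ {n d} (xs ys : Vec (Fin n) d) → encode xs ≡ encode ys → xs ≡ ys
encode-injective []       []       _   = refl
encode-injective (x ∷ xs) (y ∷ ys) eq with FP.combine-injective x (encode xs) y (encode ys) eq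
... | x≡y , exs≡eys = cong₂ _∷_ x≡y (encode-injective xs ys exs≡eys)

decode : ∀ {n} d → Fin (n ^ d) → Vec (Fin n) d
decode zero    _ = []
decode {n} (suc d) i = proj₁ (F.remQuot {n} (n ^ d) i) ∷ decode d (proj₂ (F.remQuot {n} (n ^ d) i))

encode-decode : ∀ {n} d (i : Fin (n ^ d)) → encode (decode d i) ≡ i
encode-decode zero    zero = refl
encode-decode {n} (suc d) i = trans (cong (F.combine (proj₁ (F.remQuot {n} (n ^ d) i))) (encode-decode d _))
                                   (FP.combine-remQuot {n} (n ^ d) i)

decode-injective : ∀ {n} d {i j : Fin (n ^ d)} → decode d i ≡ decode d j → i ≡ j
decode-injective d {i} {j} eq =
  trans (sym (encode-decode d i)) (trans (cong encode eq) (encode-decode d j))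

full-dirs : ∀ {n k} (r : Rook n k k) i → i ∈ dirs r
full-dirs r i = subst (i ∈_) (sym (SP.∣p∣≡n⇒p≡⊤ (size r))) SP.∈⊤

tail²-≡⇒agreeOutside : ∀ {A : Set} {d} (u v : Vec A (2 + d)) →
  V.tail (V.tail u) ≡ V.tail (V.tail v) → AgreeOutside u v zero (suc zero)
tail²-≡⇒agreeOutside (_ ∷ _ ∷ u) (_ ∷ _ ∷ v) u≡v zero 0≢0 _ = ⊥-elim (0≢0 refl)
tail²-≡⇒agreeOutside (_ ∷ _ ∷ u) (_ ∷ _ ∷ v) u≡v (suc zero) _ 1≢1 = ⊥-elim (1≢1 refl)
tail²-≡⇒agreeOutside (_ ∷ _ ∷ u) (_ ∷ _ ∷ v) u≡v (suc (suc c)) _ _ = cong (λ w → lookup w c) u≡v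

max≤n^[k∸2] : ∀ {n d m} → IsMax n (2 + d) (2 + d) m → m ≤ n ^ d
max≤n^[k∸2] {n} {d} = max≤ (n ^ d) (λ r → encode (V.tail (V.tail (pos r)))) λ r r' same →
  agreeOutside⇒conflict r r' (full-dirs r zero) (full-dirs r' (suc zero))
    (tail²-≡⇒agreeOutside (pos r) (pos r') (encode-injective _ _ same))

∑ : ∀ {d} → (Fin d → ℤ) → ℤ
∑ {zero}  f = + 0
∑ {suc d} f = f zero ℤ.+ ∑ (λ c → f (suc c))

∑-cong : ∀ {d} {f g : Fin d → ℤ} → (∀ c → f c ≡ g c) → ∑ f ≡ ∑ g
∑-cong {zero}  f≗g = refl
∑-cong {suc d} f≗g = cong₂ ℤ._+_ (f≗g zero) (∑-cong (λ c → f≗g (suc c)))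

∑-sub : ∀ {d} (f g : Fin d → ℤ) → ∑ f ℤ.- ∑ g ≡ ∑ (λ c → f c ℤ.- g c)
∑-sub {zero}  f g = refl
∑-sub {suc d} f g = trans
  (solve 4 (λ a b c e → (a :+ b) :- (c :+ e) := (a :- c) :+ (b :- e)) refl
     (f zero) (∑ (λ c → f (suc c))) (g zero) (∑ (λ c → g (suc c))))
  (cong (ℤ._+_ (f zero ℤ.- g zero)) (∑-sub (λ c → f (suc c)) (λ c → g (suc c))))
  where open Data.Integer.Solver.+-*-Solver

∑-zero : ∀ {d} (f : Fin d → ℤ) → (∀ c → f c ≡ + 0) → ∑ f ≡ + 0
∑-zero {zero}  f f≗0 = refl
∑-zero {suc d} f f≗0 rewrite f≗0 zero =
  trans (ℤP.+-identityˡ _) (∑-zero (λ c → f (suc c)) (λ c → f≗0 (suc c)))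

∑-single : ∀ {d} (f : Fin d → ℤ) c₁ → (∀ c → c ≢ c₁ → f c ≡ + 0) → ∑ f ≡ f c₁
∑-single {suc d} f zero f≗0 =
  trans (cong (ℤ._+_ (f zero)) (∑-zero _ (λ c → f≗0 (suc c) λ ()))) (ℤP.+-identityʳ (f zero))
∑-single {suc d} f (suc c₁) f≗0 rewrite f≗0 zero (λ ()) =
  trans (ℤP.+-identityˡ _) (∑-single _ c₁ (λ c c≢c₁ → f≗0 (suc c) (c≢c₁ ∘ FP.suc-injective)))

∑-pair : ∀ {d} (f : Fin d → ℤ) c₁ c₂ → c₁ ≢ c₂ → (∀ c → c ≢ c₁ → c ≢ c₂ → f c ≡ + 0) →
  ∑ f ≡ f c₁ ℤ.+ f c₂
∑-pair f zero zero c₁≢c₂ _ = ⊥-elim (c₁≢c₂ refl)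
∑-pair f zero (suc c₂) _ f≗0 =
  cong (ℤ._+_ (f zero)) (∑-single _ c₂ (λ c c≢c₂ → f≗0 (suc c) (λ ()) (c≢c₂ ∘ FP.suc-injective)))
∑-pair f (suc c₁) zero _ f≗0 =
  trans (cong (ℤ._+_ (f zero)) (∑-single _ c₁ (λ c c≢c₁ → f≗0 (suc c) (c≢c₁ ∘ FP.suc-injective) (λ ()))))
        (ℤP.+-comm (f zero) (f (suc c₁)))
∑-pair f (suc c₁) (suc c₂) c₁≢c₂ f≗0 rewrite f≗0 zero (λ ()) (λ ()) =
  trans (ℤP.+-identityˡ _)
    (∑-pair _ c₁ c₂ (c₁≢c₂ ∘ cong suc)
       (λ c c≢c₁ c≢c₂ → f≗0 (suc c) (c≢c₁ ∘ FP.suc-injective) (c≢c₂ ∘ FP.suc-injective)))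

%ℕ≡⇒∣- : ∀ {q} .{{_ : NonZero q}} i j → i %ℕ q ≡ j %ℕ q → + q ∣ i ℤ.- j
%ℕ≡⇒∣- {q} i j i≡j = divides (i /ℕ q ℤ.- j /ℕ q) (begin
  i ℤ.- j
    ≡⟨ cong₂ ℤ._-_ (a≡a%ℕn+[a/ℕn]*n i q) (a≡a%ℕn+[a/ℕn]*n j q) ⟩
  (+ (i %ℕ q) ℤ.+ i /ℕ q ℤ.* + q) ℤ.- (+ (j %ℕ q) ℤ.+ j /ℕ q ℤ.* + q)
    ≡⟨ cong (λ r → (+ (i %ℕ q) ℤ.+ i /ℕ q ℤ.* + q) ℤ.- (+ r ℤ.+ j /ℕ q ℤ.* + q)) (sym i≡j) ⟩
  (+ (i %ℕ q) ℤ.+ i /ℕ q ℤ.* + q) ℤ.- (+ (i %ℕ q) ℤ.+ j /ℕ q ℤ.* + q)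
    ≡⟨ solve 4 (λ r a b q → (r :+ a :* q) :- (r :+ b :* q) := (a :- b) :* q) refl
         (+ (i %ℕ q)) (i /ℕ q) (j /ℕ q) (+ q) ⟩
  (i /ℕ q ℤ.- j /ℕ q) ℤ.* + q ∎)
  where
  open ≡-Reasoning
  open Data.Integer.Solver.+-*-Solver

∣-⇒≡ : ∀ {q a b} → a < q → b < q → + q ∣ + a ℤ.- + b → a ≡ b
∣-⇒≡ {q} {a} {b} a<q b<q q∣a-b = ℤP.+-injective (ℤP.i-j≡0⇒i≡j (+ a) (+ b) (ℤP.∣i∣≡0⇒i≡0 ∣a-b∣≡0))
  where
  instance _ = >-nonZero (≤-trans (s≤s z≤n) a<q)
  ∣a-b∣<q : ℤ.∣ + a ℤ.- + b ∣ < q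
  ∣a-b∣<q = subst (_< q) (cong ℤ.∣_∣ (sym (ℤP.m-n≡m⊖n a b)))
    (≤-<-trans (ℤP.∣m⊝n∣≤m⊔n a b) (⊔-lub a<q b<q))
  ∣a-b∣≡0 : ℤ.∣ + a ℤ.- + b ∣ ≡ 0
  ∣a-b∣≡0 = trans (sym (m<n⇒m%n≡m ∣a-b∣<q)) (ℕ∣.n∣m⇒m%n≡0 _ q (∣⇒∣ᵤ q∣a-b))

Cancels : ℕ → ℤ → Set
Cancels q e = ∀ {u} → + q ∣ e ℤ.* u → + q ∣ u

cancels-1 : ∀ {q} → Cancels q (+ 1)
cancels-1 = subst (_ ∣_) (ℤP.*-identityˡ _)

-- e·(t·M/e) ≡ −1 modulo 1 + t·M.
∣M⇒cancels-mod-1+t*M : ∀ t {M e} → e ℕ∣.∣ M → Cancels (suc (t * M)) (+ e)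
∣M⇒cancels-mod-1+t*M t {M} {e} (ℕ∣.divides f refl) {u} q∣eu =
  subst (+ q ∣_) u*q-t*f*[e*u]≡u (∣m∣n⇒∣m-n (∣n⇒∣m*n u ∣-refl) (∣n⇒∣m*n (+ t ℤ.* + f) q∣eu))
  where
  open Data.Integer.Solver.+-*-Solver
  q = suc (t * (f * e))
  +q≡ : + q ≡ + 1 ℤ.+ + t ℤ.* (+ f ℤ.* + e)
  +q≡ = trans (ℤP.pos-+ 1 (t * (f * e)))
    (cong (ℤ._+_ (+ 1)) (trans (ℤP.pos-* t (f * e)) (cong (ℤ._*_ (+ t)) (ℤP.pos-* f e))))
  u*q-t*f*[e*u]≡u : u ℤ.* + q ℤ.- + t ℤ.* + f ℤ.* (+ e ℤ.* u) ≡ u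
  u*q-t*f*[e*u]≡u = trans (cong (λ z → u ℤ.* z ℤ.- + t ℤ.* + f ℤ.* (+ e ℤ.* u)) +q≡)
    (solve 4 (λ u t f e → u :* (con (+ 1) :+ t :* (f :* e)) :- t :* f :* (e :* u) := u)
       refl u (+ t) (+ f) (+ e))

module _ {q d : ℕ} .{{_ : NonZero q}} where

  check : (Fin d → ℕ) → Vec (Fin q) d → ℤ
  check w x = ∑ (λ c → + w c ℤ.* + toℕ (lookup x c))

  digit : (Fin d → ℕ) → Vec (Fin q) d → Fin q
  digit w x = F.fromℕ< (n%ℕd<d (check w x) q)

  δ : Vec (Fin q) d → Vec (Fin q) d → Fin d → ℤ
  δ x y c = + toℕ (lookup x c) ℤ.- + toℕ (lookup y c)

  digit-≡⇒∣ : ∀ w x y → digit w x ≡ digit w y → + q ∣ ∑ (λ c → + w c ℤ.* δ x y c)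
  digit-≡⇒∣ w x y digits≡ = subst (+ q ∣_) check-x-check-y (%ℕ≡⇒∣- (check w x) (check w y) %≡)
    where
    open Data.Integer.Solver.+-*-Solver
    %≡ : check w x %ℕ q ≡ check w y %ℕ q
    %≡ = trans (sym (FP.toℕ-fromℕ< _)) (trans (cong toℕ digits≡) (FP.toℕ-fromℕ< _))
    check-x-check-y : check w x ℤ.- check w y ≡ ∑ (λ c → + w c ℤ.* δ x y c)
    check-x-check-y =
      trans (∑-sub (λ c → + w c ℤ.* + toℕ (lookup x c)) (λ c → + w c ℤ.* + toℕ (lookup y c)))
        (∑-cong λ c → solve 3 (λ w a b → w :* a :- w :* b := w :* (a :- b))
                        refl (+ w c) (+ toℕ (lookup x c)) (+ toℕ (lookup y c)))

  w*δ≡0 : ∀ w x y c → lookup x c ≡ lookup y c → + w ℤ.* δ x y c ≡ + 0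
  w*δ≡0 w x y c xc≡yc rewrite xc≡yc | ℤP.+-inverseʳ (+ toℕ (lookup y c)) = ℤP.*-zeroʳ (+ w)

  ∣δ⇒≡ : ∀ x y c → + q ∣ δ x y c → lookup x c ≡ lookup y c
  ∣δ⇒≡ x y c q∣δ = FP.toℕ-injective (∣-⇒≡ (FP.toℕ<n (lookup x c)) (FP.toℕ<n (lookup y c)) q∣δ)

  digit-injective-off : ∀ w {c₁} x y → Cancels q (+ w c₁) →
    (∀ c → c ≢ c₁ → lookup x c ≡ lookup y c) → digit w x ≡ digit w y → x ≡ y
  digit-injective-off w {c₁} x y cancel agree digits≡ = lookup-ext x≗y
    where
    q∣w*δ : + q ∣ + w c₁ ℤ.* δ x y c₁
    q∣w*δ = subst (+ q ∣_) (∑-single _ c₁ λ c c≢c₁ → w*δ≡0 (w c) x y c (agree c c≢c₁))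
                           (digit-≡⇒∣ w x y digits≡)
    x≗y : ∀ c → lookup x c ≡ lookup y c
    x≗y c with c FP.≟ c₁
    ... | yes refl  = ∣δ⇒≡ x y c₁ (cancel q∣w*δ)
    ... | no  c≢c₁ = agree c c≢c₁

  -- The two check digits give q ∣ δ₁ + δ₂ and q ∣ w₁δ₁ + w₂δ₂, hence q ∣ (w₂ − w₁)δ₂.
  digits-injective-off₂ : ∀ w {c₁ c₂} x y → c₁ ≢ c₂ → Cancels q (+ w c₂ ℤ.- + w c₁) →
    AgreeOutside x y c₁ c₂ → digit (λ _ → 1) x ≡ digit (λ _ → 1) y → digit w x ≡ digit w y → x ≡ y
  digits-injective-off₂ w {c₁} {c₂} x y c₁≢c₂ cancel agree sums≡ digits≡ =
    digit-injective-off (λ _ → 1) x y cancels-1 agree₁ sums≡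
    where
    open Data.Integer.Solver.+-*-Solver
    δ₁ = δ x y c₁
    δ₂ = δ x y c₂
    q∣pair : ∀ w → digit w x ≡ digit w y → + q ∣ + w c₁ ℤ.* δ₁ ℤ.+ + w c₂ ℤ.* δ₂
    q∣pair w ≡w = subst (+ q ∣_)
      (∑-pair _ c₁ c₂ c₁≢c₂ λ c c≢c₁ c≢c₂ → w*δ≡0 (w c) x y c (agree c c≢c₁ c≢c₂))
      (digit-≡⇒∣ w x y ≡w)
    q∣[w₂-w₁]δ₂ : + q ∣ (+ w c₂ ℤ.- + w c₁) ℤ.* δ₂
    q∣[w₂-w₁]δ₂ = subst (+ q ∣_)
      (solve 4 (λ a b u v → (a :* u :+ b :* v) :- a :* (con (+ 1) :* u :+ con (+ 1) :* v)
                          := (b :- a) :* v)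
         refl (+ w c₁) (+ w c₂) δ₁ δ₂)
      (∣m∣n⇒∣m-n (q∣pair w digits≡) (∣n⇒∣m*n (+ w c₁) (q∣pair (λ _ → 1) sums≡)))
    agree₁ : ∀ c → c ≢ c₁ → lookup x c ≡ lookup y c
    agree₁ c c≢c₁ with c FP.≟ c₂
    ... | yes refl = ∣δ⇒≡ x y c₂ (cancel q∣[w₂-w₁]δ₂)
    ... | no  c≢c₂ = agree c c≢c₁ c≢c₂

weight : ∀ {d} → Fin d → ℕ
weight c = suc (toℕ c)

codeword : ∀ {q d} .{{_ : NonZero q}} → Vec (Fin q) d → Vec (Fin q) (2 + d)
codeword x = digit (λ _ → 1) x ∷ digit weight x ∷ x

module _ {q d : ℕ} .{{_ : NonZero q}} (cancels : ∀ {e} → 0 < e → e ≤ d → Cancels q (+ e)) where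

  private
    cancels-weight : ∀ c → Cancels q (+ weight c)
    cancels-weight c = cancels (s≤s z≤n) (FP.toℕ<n c)

    digits-injective-off-ordered : ∀ x y {c₁ c₂} → toℕ c₁ < toℕ c₂ → AgreeOutside x y c₁ c₂ →
      digit (λ _ → 1) x ≡ digit (λ _ → 1) y → digit weight x ≡ digit weight y → x ≡ y
    digits-injective-off-ordered x y {c₁} {c₂} c₁<c₂ =
      digits-injective-off₂ weight x y (λ c₁≡c₂ → <-irrefl (cong toℕ c₁≡c₂) c₁<c₂)
        (subst (Cancels q) (sym gap≡)
          (cancels (m<n⇒0<n∸m c₁<c₂) (≤-trans (m∸n≤m (toℕ c₂) (toℕ c₁)) (<⇒≤ (FP.toℕ<n c₂)))))
      where
      gap≡ : + weight c₂ ℤ.- + weight c₁ ≡ + (toℕ c₂ ∸ toℕ c₁)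
      gap≡ = trans (ℤP.m-n≡m⊖n (weight c₂) (weight c₁)) (ℤP.⊖-≥ (s≤s (<⇒≤ c₁<c₂)))

    2+-≢ : ∀ {c c′ : Fin d} → c ≢ c′ → _≢_ {A = Fin (2 + d)} (suc (suc c)) (suc (suc c′))
    2+-≢ c≢c′ eq = c≢c′ (FP.suc-injective (FP.suc-injective eq))

  codeword-separated : ∀ (x y : Vec (Fin q) d) {i j} → AgreeOutside (codeword x) (codeword y) i j → x ≡ y
  codeword-separated x y {zero}     {zero}     agree = lookup-ext λ c → agree (suc (suc c)) (λ ()) (λ ())
  codeword-separated x y {zero}     {suc zero} agree = lookup-ext λ c → agree (suc (suc c)) (λ ()) (λ ())
  codeword-separated x y {suc zero} {zero}     agree = lookup-ext λ c → agree (suc (suc c)) (λ ()) (λ ())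
  codeword-separated x y {suc zero} {suc zero} agree = lookup-ext λ c → agree (suc (suc c)) (λ ()) (λ ())
  codeword-separated x y {zero} {suc (suc c₂)} agree =
    digit-injective-off weight x y (cancels-weight c₂)
      (λ c c≢c₂ → agree (suc (suc c)) (λ ()) (2+-≢ c≢c₂)) (agree (suc zero) (λ ()) (λ ()))
  codeword-separated x y {suc zero} {suc (suc c₂)} agree =
    digit-injective-off (λ _ → 1) x y cancels-1
      (λ c c≢c₂ → agree (suc (suc c)) (λ ()) (2+-≢ c≢c₂)) (agree zero (λ ()) (λ ()))
  codeword-separated x y {suc (suc _)} {zero} agree =
    codeword-separated x y (swap-agreeOutside {u = codeword x} {codeword y} agree)
  codeword-separated x y {suc (suc _)} {suc zero} agree =
    codeword-separated x y (swap-agreeOutside {u = codeword x} {codeword y} agree)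
  codeword-separated x y {suc (suc c₁)} {suc (suc c₂)} agree with <-cmp (toℕ c₁) (toℕ c₂)
  ... | tri< c₁<c₂ _ _ = digits-injective-off-ordered x y c₁<c₂
    (λ c c≢c₁ c≢c₂ → agree (suc (suc c)) (2+-≢ c≢c₁) (2+-≢ c≢c₂))
    (agree zero (λ ()) (λ ())) (agree (suc zero) (λ ()) (λ ()))
  ... | tri> _ _ c₂<c₁ = digits-injective-off-ordered x y c₂<c₁
    (λ c c≢c₂ c≢c₁ → agree (suc (suc c)) (2+-≢ c≢c₁) (2+-≢ c≢c₂))
    (agree zero (λ ()) (λ ())) (agree (suc zero) (λ ()) (λ ()))
  ... | tri≈ _ c₁≡c₂ _ with FP.toℕ-injective c₁≡c₂
  ...   | refl = digit-injective-off (λ _ → 1) x y cancels-1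
    (λ c c≢c₁ → agree (suc (suc c)) (2+-≢ c≢c₁) (2+-≢ c≢c₁)) (agree zero (λ ()) (λ ()))

0<m≤n⇒m∣n! : ∀ {m n} → 0 < m → m ≤ n → m ℕ∣.∣ n !
0<m≤n⇒m∣n! {suc m} _ m<n = ℕ∣.∣-trans (ℕ∣.m∣m*n (m !)) (ℕ∣.m≤n⇒m!∣n! m<n)

-- q = 1 + t·d! makes every weight difference 1, …, d invertible modulo q.
[1+t*d!]^d≤max : ∀ {n d m} t → suc (t * d !) ≤ n → IsMax n (2 + d) (2 + d) m →
  suc (t * d !) ^ d ≤ m
[1+t*d!]^d≤max {n} {d} t q≤n = ≤max (suc (t * d !) ^ d) rookAt conflict-free
  where
  q = suc (t * d !)
  embed : Fin q → Fin n
  embed i = F.inject≤ i q≤n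
  rookAt : Fin (q ^ d) → Rook n (2 + d) (2 + d)
  rookAt a = rook (V.map embed (codeword (decode d a))) ⊤ (SP.∣⊤∣≡n _)
  cancels : ∀ {e} → 0 < e → e ≤ d → Cancels q (+ e)
  cancels 0<e e≤d = ∣M⇒cancels-mod-1+t*M t (0<m≤n⇒m∣n! 0<e e≤d)
  conflict-free : ∀ a b → a ≢ b → ¬ Conflict (rookAt a) (rookAt b)
  conflict-free a b a≢b conflict
    with conflict⇒agreeOutside (rookAt a) (rookAt b) (SP.∈⊤ {x = zero}) (SP.∈⊤ {x = zero}) conflict
  ... | _ , _ , _ , _ , agree = a≢b (decode-injective d (codeword-separated cancels _ _
    (agreeOutside-map⁻¹ {u = codeword (decode d a)} {codeword (decode d b)}
      (FP.inject≤-injective q≤n q≤n _ _) agree)))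

[n∸d!]^d≤max : ∀ {n d m} → 0 < n → IsMax n (2 + d) (2 + d) m → (n ∸ d !) ^ d ≤ m
[n∸d!]^d≤max {suc n} {d} _ max = ≤-trans (^-monoˡ-≤ d n∸d!≤q) ([1+t*d!]^d≤max t q≤1+n max)
  where
  M = d !
  instance _ = d !≢0
  t = n / M
  n≡ : n ≡ n % M + t * M
  n≡ = m≡m%n+[m/n]*n n M
  q≤1+n : suc (t * M) ≤ suc n
  q≤1+n = s≤s (subst (t * M ≤_) (sym n≡) (m≤n+m _ (n % M)))
  n∸d!≤q : suc n ∸ M ≤ suc (t * M)
  n∸d!≤q = m≤n+o⇒m∸n≤o (suc n) M (begin
    suc n                 ≡⟨ cong suc n≡ ⟩
    suc (n % M + t * M)   ≤⟨ s≤s (+-monoˡ-≤ (t * M) (<⇒≤ (m%n<n n M))) ⟩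
    suc (M + t * M)       ≡⟨ sym (+-suc M (t * M)) ⟩
    M + suc (t * M)       ∎)
    where open ≤-Reasoning

-- Rooks with two directions

pairCount : ℕ → ℕ
pairCount zero    = 0
pairCount (suc m) = pairCount m + m

pairCount≡C2 : ∀ m → pairCount m ≡ m C 2
pairCount≡C2 zero    = refl
pairCount≡C2 (suc m) = begin
  pairCount m + m   ≡⟨ cong₂ _+_ (pairCount≡C2 m) (sym (nC1≡n m)) ⟩
  m C 2 + m C 1     ≡⟨ +-comm (m C 2) (m C 1) ⟩
  m C 1 + m C 2     ≡⟨ nCk+nC[k+1]≡[n+1]C[k+1] m 1 ⟩
  suc m C 2         ∎
  where open ≡-Reasoning

-- Two-element subsets {π₁ c, π₂ c} of Fin m with π₁ c < π₂ c.
data Pair : ℕ → Set where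
  first : ∀ {m} → Fin m → Pair (suc m)
  later : ∀ {m} → Pair m → Pair (suc m)

π₁ π₂ : ∀ {m} → Pair m → Fin m
π₁ (first _) = zero
π₁ (later c) = suc (π₁ c)
π₂ (first r) = suc r
π₂ (later c) = suc (π₂ c)

π₁<π₂ : ∀ {m} (c : Pair m) → toℕ (π₁ c) < toℕ (π₂ c)
π₁<π₂ (first _) = s≤s z≤n
π₁<π₂ (later c) = s≤s (π₁<π₂ c)

π₁≢π₂ : ∀ {m} (c : Pair m) → π₁ c ≢ π₂ c
π₁≢π₂ c π₁≡π₂ = <-irrefl (cong toℕ π₁≡π₂) (π₁<π₂ c)

π-injective : ∀ {m} {c c′ : Pair m} → π₁ c ≡ π₁ c′ → π₂ c ≡ π₂ c′ → c ≡ c′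
π-injective {c = first r} {first r′} _ π₂≡ = cong first (FP.suc-injective π₂≡)
π-injective {c = later c} {later c′} π₁≡ π₂≡ =
  cong later (π-injective (FP.suc-injective π₁≡) (FP.suc-injective π₂≡))

toFin : ∀ {m} → Pair m → Fin (pairCount m)
toFin {suc m} (first r) = pairCount m F.↑ʳ r
toFin {suc m} (later c) = toFin c F.↑ˡ m

fromFin : ∀ {m} → Fin (pairCount m) → Pair m
fromFin {suc m} i with F.splitAt (pairCount m) i
... | inj₁ j = later (fromFin j)
... | inj₂ r = first r

toFin-fromFin : ∀ {m} (i : Fin (pairCount m)) → toFin (fromFin {m} i) ≡ i
toFin-fromFin {suc m} i with F.splitAt (pairCount m) i in eq
... | inj₁ j = trans (cong (F._↑ˡ m) (toFin-fromFin {m} j))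
                   (trans (cong (F.join (pairCount m) m) (sym eq)) (FP.join-splitAt (pairCount m) m i))
... | inj₂ r = trans (cong (F.join (pairCount m) m) (sym eq)) (FP.join-splitAt (pairCount m) m i)

fromFin-toFin : ∀ {m} (c : Pair m) → fromFin (toFin c) ≡ c
fromFin-toFin {suc m} (first r) rewrite FP.splitAt-↑ʳ (pairCount m) m r = refl
fromFin-toFin {suc m} (later c) rewrite FP.splitAt-↑ˡ (pairCount m) (toFin c) m =
  cong later (fromFin-toFin c)

toFin-injective : ∀ {m} {c c′ : Pair m} → toFin c ≡ toFin c′ → c ≡ c′
toFin-injective {c = c} {c′} eq =
  trans (sym (fromFin-toFin c)) (trans (cong fromFin eq) (fromFin-toFin c′))

fromFin-injective : ∀ {m} {i j : Fin (pairCount m)} → fromFin {m} i ≡ fromFin j → i ≡ j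
fromFin-injective {m} {i} {j} eq =
  trans (sym (toFin-fromFin {m} i)) (trans (cong toFin eq) (toFin-fromFin {m} j))

toSubset : ∀ {m} → Pair m → Subset m
toSubset (first r) = inside ∷ ⁅ r ⁆
toSubset (later c) = outside ∷ toSubset c

∣toSubset∣≡2 : ∀ {m} (c : Pair m) → ∣ toSubset c ∣ ≡ 2
∣toSubset∣≡2 (first r) = cong suc (SP.∣⁅x⁆∣≡1 r)
∣toSubset∣≡2 (later c) = ∣toSubset∣≡2 c

π₁∈toSubset : ∀ {m} (c : Pair m) → π₁ c ∈ toSubset c
π₁∈toSubset (first _) = here
π₁∈toSubset (later c) = there (π₁∈toSubset c)

π₂∈toSubset : ∀ {m} (c : Pair m) → π₂ c ∈ toSubset c
π₂∈toSubset (first r) = there (SP.x∈⁅x⁆ r)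
π₂∈toSubset (later c) = there (π₂∈toSubset c)

∈toSubset⇒π : ∀ {m} (c : Pair m) {x} → x ∈ toSubset c → x ≡ π₁ c ⊎ x ≡ π₂ c
∈toSubset⇒π (first r) here         = inj₁ refl
∈toSubset⇒π (first r) (there x∈⁅r⁆) = inj₂ (cong suc (SP.x∈⁅y⁆⇒x≡y r x∈⁅r⁆))
∈toSubset⇒π (later c) (there x∈c) with ∈toSubset⇒π c x∈c
... | inj₁ x≡π₁ = inj₁ (cong suc x≡π₁)
... | inj₂ x≡π₂ = inj₂ (cong suc x≡π₂)

∣p∣≡0⇒p≡∅ : ∀ {m} (p : Subset m) → ∣ p ∣ ≡ 0 → p ≡ ∅
∣p∣≡0⇒p≡∅ []            _     = refl
∣p∣≡0⇒p≡∅ (outside ∷ p) ∣p∣≡0 = cong (outside ∷_) (∣p∣≡0⇒p≡∅ p ∣p∣≡0)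

elementOf : ∀ {m} (p : Subset m) → ∣ p ∣ ≡ 1 → Fin m
elementOf (inside ∷ _)  _     = zero
elementOf (outside ∷ p) ∣p∣≡1 = suc (elementOf p ∣p∣≡1)

⁅elementOf⁆ : ∀ {m} (p : Subset m) (∣p∣≡1 : ∣ p ∣ ≡ 1) → ⁅ elementOf p ∣p∣≡1 ⁆ ≡ p
⁅elementOf⁆ (inside ∷ p)  ∣p∣≡1 = cong (inside ∷_) (sym (∣p∣≡0⇒p≡∅ p (suc-injective ∣p∣≡1)))
⁅elementOf⁆ (outside ∷ p) ∣p∣≡1 = cong (outside ∷_) (⁅elementOf⁆ p ∣p∣≡1)

pairOf : ∀ {m} (p : Subset m) → ∣ p ∣ ≡ 2 → Pair m
pairOf (inside ∷ p)  ∣p∣≡2 = first (elementOf p (suc-injective ∣p∣≡2))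
pairOf (outside ∷ p) ∣p∣≡2 = later (pairOf p ∣p∣≡2)

toSubset-pairOf : ∀ {m} (p : Subset m) (∣p∣≡2 : ∣ p ∣ ≡ 2) → toSubset (pairOf p ∣p∣≡2) ≡ p
toSubset-pairOf (inside ∷ p)  ∣p∣≡2 = cong (inside ∷_) (⁅elementOf⁆ p (suc-injective ∣p∣≡2))
toSubset-pairOf (outside ∷ p) ∣p∣≡2 = cong (outside ∷_) (toSubset-pairOf p ∣p∣≡2)

erase : ∀ {A : Set} {d} → Pair (2 + d) → Vec A (2 + d) → Vec A d
erase (first r) (_ ∷ v) = V.removeAt v r
erase {d = suc d} (later c) (a ∷ v) = a ∷ erase c v
erase {d = zero}  (later (first ())) _

insert : ∀ {A : Set} {d} → Pair (2 + d) → A → A → Vec A d → Vec A (2 + d)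
insert (first r) a b w = a ∷ V.insertAt w r b
insert {d = suc d} (later c) a b (x ∷ w) = x ∷ insert c a b w
insert {d = zero}  (later (first ())) _ _ _

erase-≡⇒agreeOutside : ∀ {A : Set} {d} (c : Pair (2 + d)) (u v : Vec A (2 + d)) →
  erase c u ≡ erase c v → AgreeOutside u v (π₁ c) (π₂ c)
erase-≡⇒agreeOutside (first r) (_ ∷ u) (_ ∷ v) _ zero 0≢0 _ = ⊥-elim (0≢0 refl)
erase-≡⇒agreeOutside (first r) (_ ∷ u) (_ ∷ v) u≡v (suc x) _ x≢r = begin
  lookup u x                          ≡⟨ VP.removeAt-punchOut u r≢x ⟨
  lookup (V.removeAt u r) (F.punchOut r≢x) ≡⟨ cong (λ w → lookup w (F.punchOut r≢x)) u≡v ⟩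
  lookup (V.removeAt v r) (F.punchOut r≢x) ≡⟨ VP.removeAt-punchOut v r≢x ⟩
  lookup v x                          ∎
  where
  open ≡-Reasoning
  r≢x : r ≢ x
  r≢x r≡x = x≢r (cong suc (sym r≡x))
erase-≡⇒agreeOutside {d = suc d} (later c) (_ ∷ u) (_ ∷ v) u≡v zero _ _ = cong V.head u≡v
erase-≡⇒agreeOutside {d = suc d} (later c) (_ ∷ u) (_ ∷ v) u≡v (suc x) x≢π₁ x≢π₂ =
  erase-≡⇒agreeOutside c u v (cong V.tail u≡v) x (x≢π₁ ∘ cong suc) (x≢π₂ ∘ cong suc)
erase-≡⇒agreeOutside {d = zero} (later (first ())) _ _ _

erase-insert : ∀ {A : Set} {d} (c : Pair (2 + d)) (a b : A) w → erase c (insert c a b w) ≡ w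
erase-insert (first r) a b w = VP.removeAt-insertAt w r b
erase-insert {d = suc d} (later c) a b (x ∷ w) = cong (x ∷_) (erase-insert c a b w)
erase-insert {d = zero}  (later (first ())) _ _ _

lookup-insert-π₁ : ∀ {A : Set} {d} (c : Pair (2 + d)) (a b : A) w → lookup (insert c a b w) (π₁ c) ≡ a
lookup-insert-π₁ (first r) a b w = refl
lookup-insert-π₁ {d = suc d} (later c) a b (x ∷ w) = lookup-insert-π₁ c a b w
lookup-insert-π₁ {d = zero}  (later (first ())) _ _ _

lookup-insert-π₂ : ∀ {A : Set} {d} (c : Pair (2 + d)) (a b : A) w → lookup (insert c a b w) (π₂ c) ≡ b
lookup-insert-π₂ (first r) a b w = VP.insertAt-lookup w r b
lookup-insert-π₂ {d = suc d} (later c) a b (x ∷ w) = lookup-insert-π₂ c a b w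
lookup-insert-π₂ {d = zero}  (later (first ())) _ _ _

lookup-insert-other : ∀ {A : Set} {d} (c : Pair (2 + d)) (a b : A) w {x} → x ≢ π₁ c → x ≢ π₂ c →
  ∃ λ i → lookup (insert c a b w) x ≡ lookup w i
lookup-insert-other (first r) a b w {zero} 0≢0 _ = ⊥-elim (0≢0 refl)
lookup-insert-other (first r) a b w {suc x} _ x≢r =
  F.punchOut r≢x , trans (cong (lookup (V.insertAt w r b)) (sym (FP.punchIn-punchOut r≢x)))
                         (VP.insertAt-punchIn w r b (F.punchOut r≢x))
  where
  r≢x : r ≢ x
  r≢x r≡x = x≢r (cong suc (sym r≡x))
lookup-insert-other {d = suc d} (later c) a b (y ∷ w) {zero} _ _ = zero , refl
lookup-insert-other {d = suc d} (later c) a b (y ∷ w) {suc x} x≢π₁ x≢π₂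
  with lookup-insert-other c a b w (x≢π₁ ∘ cong suc) (x≢π₂ ∘ cong suc)
... | i , eq = suc i , eq
lookup-insert-other {d = zero} (later (first ())) _ _ _

erase-≡⇒conflict : ∀ {n d} (r r' : Rook n (2 + d) 2) (c : Pair (2 + d)) →
  toSubset c ≡ dirs r → toSubset c ≡ dirs r' → erase c (pos r) ≡ erase c (pos r') → Conflict r r'
erase-≡⇒conflict r r' c c≡D c≡D' erase≡ = agreeOutside⇒conflict r r'
  (subst (π₁ c ∈_) c≡D (π₁∈toSubset c)) (subst (π₂ c ∈_) c≡D' (π₂∈toSubset c))
  (erase-≡⇒agreeOutside c (pos r) (pos r') erase≡)

max≤pairCount*n^[k∸2] : ∀ {n d m} → IsMax n (2 + d) 2 m → m ≤ pairCount (2 + d) * n ^ d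
max≤pairCount*n^[k∸2] {n} {d} = max≤ (pairCount (2 + d) * n ^ d) label conflicting
  where
  pairOfDirs : Rook n (2 + d) 2 → Pair (2 + d)
  pairOfDirs r = pairOf (dirs r) (size r)
  label : Rook n (2 + d) 2 → Fin (pairCount (2 + d) * n ^ d)
  label r = F.combine (toFin (pairOfDirs r)) (encode (erase (pairOfDirs r) (pos r)))
  conflicting : ∀ r r' → label r ≡ label r' → Conflict r r'
  conflicting r r' same with FP.combine-injective _ _ _ _ same
  ... | toFin≡ , encode≡ = erase-≡⇒conflict r r' (pairOfDirs r)
    (toSubset-pairOf (dirs r) (size r))
    (trans (cong toSubset c≡c′) (toSubset-pairOf (dirs r') (size r')))
    (trans (encode-injective _ _ encode≡) (cong (λ c → erase c (pos r')) (sym c≡c′)))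
    where
    c≡c′ : pairOfDirs r ≡ pairOfDirs r'
    c≡c′ = toFin-injective toFin≡

Partners : ∀ {m} → Pair m → Fin m → Fin m → Set
Partners c x e = (x ≡ π₁ c × e ≡ π₂ c) ⊎ (x ≡ π₂ c × e ≡ π₁ c)

partners-sym : ∀ {m} {c : Pair m} {x e} → Partners c x e → Partners c e x
partners-sym (inj₁ (x≡ , e≡)) = inj₂ (e≡ , x≡)
partners-sym (inj₂ (x≡ , e≡)) = inj₁ (e≡ , x≡)

partners-≢ : ∀ {m} {c : Pair m} {x e} → Partners c x e → x ≢ e
partners-≢ {c = c} (inj₁ (refl , refl)) = π₁≢π₂ c
partners-≢ {c = c} (inj₂ (refl , refl)) = π₁≢π₂ c ∘ sym

partners-unique : ∀ {m} {c c′ : Pair m} {x e} → Partners c x e → Partners c′ x e → c ≡ c′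
partners-unique (inj₁ (x≡ , e≡)) (inj₁ (x≡′ , e≡′)) =
  π-injective (trans (sym x≡) x≡′) (trans (sym e≡) e≡′)
partners-unique (inj₂ (x≡ , e≡)) (inj₂ (x≡′ , e≡′)) =
  π-injective (trans (sym e≡) e≡′) (trans (sym x≡) x≡′)
partners-unique {c = c} {c′} (inj₁ (refl , refl)) (inj₂ (x≡ , e≡)) =
  ⊥-elim (<-asym (π₁<π₂ c) (subst₂ (λ a b → toℕ a < toℕ b) (sym e≡) (sym x≡) (π₁<π₂ c′)))
partners-unique {c = c} {c′} (inj₂ (refl , refl)) (inj₁ (x≡ , e≡)) =
  ⊥-elim (<-asym (π₁<π₂ c) (subst₂ (λ a b → toℕ a < toℕ b) (sym x≡) (sym e≡) (π₁<π₂ c′)))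

∈toSubset⇒partners : ∀ {m} (c : Pair m) {x} → x ∈ toSubset c → ∃ (Partners c x)
∈toSubset⇒partners c x∈c with ∈toSubset⇒π c x∈c
... | inj₁ x≡π₁ = π₂ c , inj₁ (x≡π₁ , refl)
... | inj₂ x≡π₂ = π₁ c , inj₂ (x≡π₂ , refl)

module Labelled {A B : Set} {d} (lab : Fin (2 + d) → A) (emb : B → A)
         (lab-injective : ∀ {x y} → lab x ≡ lab y → x ≡ y)
         (emb-injective : ∀ {f g} → emb f ≡ emb g → f ≡ g)
         (lab≢emb : ∀ x f → lab x ≢ emb f) where

  labelled : Pair (2 + d) → Vec B d → Vec A (2 + d)
  labelled c w = insert c (lab (π₂ c)) (lab (π₁ c)) (V.map emb w)

  partners⇒labelled : ∀ c w {x e} → Partners c x e → lookup (labelled c w) x ≡ lab e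
  partners⇒labelled c w (inj₁ (refl , refl)) = lookup-insert-π₁ c _ _ (V.map emb w)
  partners⇒labelled c w (inj₂ (refl , refl)) = lookup-insert-π₂ c _ _ (V.map emb w)

  labelled⇒partners : ∀ c w {x e} → lookup (labelled c w) x ≡ lab e → Partners c x e
  labelled⇒partners c w {x} {e} x↦e with x FP.≟ π₁ c | x FP.≟ π₂ c
  ... | yes refl | _        =
    inj₁ (refl , lab-injective (trans (sym x↦e) (lookup-insert-π₁ c _ _ (V.map emb w))))
  ... | no  _    | yes refl =
    inj₂ (refl , lab-injective (trans (sym x↦e) (lookup-insert-π₂ c _ _ (V.map emb w))))
  ... | no x≢π₁  | no x≢π₂  with lookup-insert-other c (lab (π₂ c)) (lab (π₁ c)) (V.map emb w) x≢π₁ x≢π₂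
  ...   | i , x↦wᵢ =
    ⊥-elim (lab≢emb e (lookup w i) (trans (sym x↦e) (trans x↦wᵢ (VP.lookup-map i emb w))))

  -- The partner ā of a keeps its label lab a in both vectors unless ā = b, and then the partner of b
  -- does; a coordinate with its label determines the pair.
  agreeOutside-labelled⇒same-pair : ∀ {c c′ w w′ a b} → a ∈ toSubset c → b ∈ toSubset c′ →
    AgreeOutside (labelled c w) (labelled c′ w′) a b → c ≡ c′
  agreeOutside-labelled⇒same-pair {c} {c′} {w} {w′} {a} {b} a∈c b∈c′ agree
    with ∈toSubset⇒partners c a∈c
  ... | ā , a~ā with ā FP.≟ b
  ...   | no ā≢b = partners-unique (partners-sym a~ā) (labelled⇒partners c′ w′
          (trans (sym (agree ā (partners-≢ a~ā ∘ sym) ā≢b)) (partners⇒labelled c w (partners-sym a~ā))))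
  ...   | yes refl with ∈toSubset⇒partners c′ b∈c′
  ...     | b̄ , b~b̄ with b̄ FP.≟ a
  ...       | no b̄≢a = partners-unique (labelled⇒partners c w
              (trans (agree b̄ b̄≢a (partners-≢ b~b̄ ∘ sym)) (partners⇒labelled c′ w′ (partners-sym b~b̄))))
              (partners-sym b~b̄)
  ...       | yes refl = partners-unique a~ā (partners-sym b~b̄)

  agreeOutside-labelled⇒≡ : ∀ {c w w′ a b} → a ∈ toSubset c → b ∈ toSubset c →
    AgreeOutside (labelled c w) (labelled c w′) a b → w ≡ w′
  agreeOutside-labelled⇒≡ {c} {w} {w′} {a} {b} a∈c b∈c agree = lookup-ext λ i → emb-injective
    (trans (sym (VP.lookup-map i emb w)) (trans (cong (λ v → lookup v i) map≡) (VP.lookup-map i emb w′)))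
    where
    off-pair : ∀ {x y} → y ∈ toSubset c → x ≢ π₁ c → x ≢ π₂ c → x ≢ y
    off-pair y∈c x≢π₁ x≢π₂ x≡y with ∈toSubset⇒π c y∈c
    ... | inj₁ y≡π₁ = x≢π₁ (trans x≡y y≡π₁)
    ... | inj₂ y≡π₂ = x≢π₂ (trans x≡y y≡π₂)
    P≗Q : ∀ x → lookup (labelled c w) x ≡ lookup (labelled c w′) x
    P≗Q x with x FP.≟ π₁ c | x FP.≟ π₂ c
    ... | yes refl | _        = trans (lookup-insert-π₁ c _ _ _) (sym (lookup-insert-π₁ c _ _ _))
    ... | no _     | yes refl = trans (lookup-insert-π₂ c _ _ _) (sym (lookup-insert-π₂ c _ _ _))
    ... | no x≢π₁  | no x≢π₂  = agree x (off-pair a∈c x≢π₁ x≢π₂) (off-pair b∈c x≢π₁ x≢π₂)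
    map≡ : V.map emb w ≡ V.map emb w′
    map≡ = trans (sym (erase-insert c _ _ (V.map emb w)))
             (trans (cong (erase c) (lookup-ext P≗Q)) (erase-insert c _ _ (V.map emb w′)))

↑ˡ≢↑ʳ : ∀ {m n} (i : Fin m) (j : Fin n) → i F.↑ˡ n ≢ m F.↑ʳ j
↑ˡ≢↑ʳ {m} {n} i j eq
  with trans (sym (FP.splitAt-↑ˡ m i n)) (trans (cong (F.splitAt m) eq) (FP.splitAt-↑ʳ m n j))
... | ()

pairCount*[n∸k]^[k∸2]≤max : ∀ {n d m} → 2 + d ≤ n → IsMax n (2 + d) 2 m →
  pairCount (2 + d) * (n ∸ (2 + d)) ^ d ≤ m
pairCount*[n∸k]^[k∸2]≤max {n} {d} {m} k≤n max =
  ≤max (pairCount k * n′ ^ d) rookAt conflict-free (subst (λ n → IsMax n k 2 m) (sym (m+[n∸m]≡n k≤n)) max)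
  where
  k = 2 + d
  n′ = n ∸ k
  lab : Fin k → Fin (k + n′)
  lab x = x F.↑ˡ n′
  emb : Fin n′ → Fin (k + n′)
  emb f = k F.↑ʳ f
  lab-injective : ∀ {x y} → lab x ≡ lab y → x ≡ y
  lab-injective = FP.↑ˡ-injective n′ _ _
  emb-injective : ∀ {f g} → emb f ≡ emb g → f ≡ g
  emb-injective = FP.↑ʳ-injective k _ _
  open Labelled lab emb lab-injective emb-injective ↑ˡ≢↑ʳ
  pairAt : Fin (pairCount k * n′ ^ d) → Pair k
  pairAt i = fromFin (proj₁ (F.remQuot {pairCount k} (n′ ^ d) i))
  fillAt : Fin (pairCount k * n′ ^ d) → Vec (Fin n′) d
  fillAt i = decode d (proj₂ (F.remQuot {pairCount k} (n′ ^ d) i))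
  rookOf : Pair k → Vec (Fin n′) d → Rook (k + n′) k 2
  rookOf c w = rook (labelled c w) (toSubset c) (∣toSubset∣≡2 c)
  rookOf-conflict⇒≡ : ∀ {c c′ w w′} → Conflict (rookOf c w) (rookOf c′ w′) → c ≡ c′ × w ≡ w′
  rookOf-conflict⇒≡ {c} {c′} conflict
    with conflict⇒agreeOutside (rookOf c _) (rookOf c′ _) (π₁∈toSubset c) (π₁∈toSubset c′) conflict
  ... | a , b , a∈c , b∈c′ , agree with agreeOutside-labelled⇒same-pair a∈c b∈c′ agree
  ... | refl = refl , agreeOutside-labelled⇒≡ a∈c b∈c′ agree
  rookAt : Fin (pairCount k * n′ ^ d) → Rook (k + n′) k 2
  rookAt i = rookOf (pairAt i) (fillAt i)
  index-injective : ∀ {i j} → pairAt i ≡ pairAt j → fillAt i ≡ fillAt j → i ≡ j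
  index-injective {i} {j} pair≡ fill≡ = trans (sym (FP.combine-remQuot {pairCount k} (n′ ^ d) i))
    (trans (cong₂ F.combine (fromFin-injective {k} pair≡) (decode-injective d fill≡))
           (FP.combine-remQuot {pairCount k} (n′ ^ d) j))
  conflict-free : ∀ i j → i ≢ j → ¬ Conflict (rookAt i) (rookAt j)
  conflict-free i j i≢j conflict with rookOf-conflict⇒≡ conflict
  ... | pair≡ , fill≡ = i≢j (index-injective pair≡ fill≡)

theorem21 : ∀ (k : ℕ) → 2 ≤ k → CLimit k k 1ℚ × CLimit k 2 (ℕ→ℚ (k C 2))
theorem21 (suc zero) (s≤s ())
theorem21 (suc (suc d)) _ = c[k,k]≡1 , c[k,2]≡kC2
  where
  c[k,k]≡1 : CLimit (2 + d) (2 + d) 1ℚ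
  c[k,k]≡1 = sandwich⇒CLimit 1 (d !) 1 λ n 1≤n m max →
    subst (_≤ m) (sym (*-identityˡ _)) ([n∸d!]^d≤max 1≤n max) ,
    subst (m ≤_) (sym (*-identityˡ _)) (max≤n^[k∸2] max)
  c[k,2]≡kC2 : CLimit (2 + d) 2 (ℕ→ℚ ((2 + d) C 2))
  c[k,2]≡kC2 = subst (λ c → CLimit (2 + d) 2 (ℕ→ℚ c)) (pairCount≡C2 (2 + d))
    (sandwich⇒CLimit (pairCount (2 + d)) (2 + d) (2 + d) λ n k≤n m max →
      pairCount*[n∸k]^[k∸2]≤max k≤n max , max≤pairCount*n^[k∸2] max)
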